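{- Let $b\ge1$ be an integer and let $\beta$ be the map from $\mathcal{M}^b$ to nonnegative integers defined by $\beta(f)=\sum_{i\ge0}f(i)(b+1)^i$ (so the base-$(b+1)$ digits of $\beta(f)$ are $f(k)f(k-1)\ldots f(0)$ where $k$ is the largest element of the support; $\beta$ of the zero function is $0$). Then $\beta$ is a monoid homomorphism from $\mathcal{M}^b$ equipped with multisumset addition to the nonnegative integers equipped with base-$(b+1)$ lunar multiplication; that is, $\beta(f+g)=\beta(f)\otimes\beta(g)$ for all $f,g\in\mathcal{M}^b$, and the neutral element of $\mathcal{M}^b$ (the multiset consisting of $0$ with multiplicity $b$) is mapped to $b$, the neutral element of lunar multiplication.
   Context: $\mathbb{N}=\{0,1,2,\ldots\}$. $\mathcal{M}^b$ is the set of functions $f:\mathbb{N}\to\{0,1,\ldots,b\}$ with finite support. The set-array representation of $f\in\mathcal{M}^b$ is $(A_1,\ldots,A_b)$ with $A_i=\{a\in\mathbb{N}:f(a)\ge i\}$. The (multisumset) sum of $f,g\in\mathcal{M}^b$ with set arrays $(A_i)$, $(B_i)$ is the element of $\mathcal{M}^b$ with set array $(A_1+B_1,\ldots,A_b+B_b)$, where $X+Y=\{x+y:x\in X,y\in Y\}$ and $X+\emptyset=\emptyset$. Base-$B$ lunar multiplication ($B\ge2$): for nonnegative integers $x=\sum_i x_iB^i$, $y=\sum_i y_iB^i$ with base-$B$ digits, $x\otimes y=\sum_i c_iB^i$ where $c_i=\max_{j+l=i}\min(x_j,y_l)$. -}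

module Defs where

open import Data.Nat using (ℕ; zero; suc; _+_; _*_; _∸_; _^_; _≤_; _⊔_; _⊓_; NonZero)
open import Data.Nat.DivMod using (_/_; _%_)
open import Data.Product using (Σ; ∃; _×_; _,_; proj₁)
open import Relation.Binary.PropositionalEquality using (_≡_)
open import Function.Bundles using (_⇔_)
open import Data.Nat.Properties using (m^n≢0)

sumBelow : ℕ → (ℕ → ℕ) → ℕ
sumBelow zero    f = 0
sumBelow (suc n) f = sumBelow n f + f n

maxUpTo : ℕ → (ℕ → ℕ) → ℕ
maxUpTo zero    f = f 0
maxUpTo (suc n) f = maxUpTo n f ⊔ f (suc n)

record M (b : ℕ) : Set where
  field
    fn      : ℕ → ℕ
    bounded : ∀ a → fn a ≤ b
    finSupp : ∃ λ N → ∀ a → N ≤ a → fn a ≡ 0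
open M public

setArray : ∀ {b} → M b → ℕ → ℕ → Set
setArray f i a = i ≤ fn f a

_+ₛ_ : (ℕ → Set) → (ℕ → Set) → ℕ → Set
(X +ₛ Y) c = Σ ℕ λ x → Σ ℕ λ y → (x + y ≡ c) × X x × Y y

IsMultisumsetSum : ∀ {b} → M b → M b → M b → Set
IsMultisumsetSum {b} f g h =
  ∀ i → 1 ≤ i → i ≤ b → ∀ c → setArray h i c ⇔ (setArray f i +ₛ setArray g i) c

-- β(f) = Σ_i f(i) (b+1)^i  (the sum is finite; summing below any support bound)
β : ∀ {b} → M b → ℕ
β {b} f = sumBelow (proj₁ (finSupp f)) λ i → fn f i * (suc b) ^ i

unitM : (b : ℕ) → M b
unitM b = record { fn = e ; bounded = bd ; finSupp = 1 , sp }
  where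
  open import Data.Nat.Properties using (≤-refl)
  open import Data.Nat using (z≤n; s≤s)
  open import Relation.Binary.PropositionalEquality using (refl)
  e : ℕ → ℕ
  e zero    = b
  e (suc _) = 0
  bd : ∀ a → e a ≤ b
  bd zero    = ≤-refl
  bd (suc _) = z≤n
  sp : ∀ a → 1 ≤ a → e a ≡ 0
  sp (suc _) _ = refl

digit : (B : ℕ) → .{{_ : NonZero B}} → ℕ → ℕ → ℕ
digit B x i = (x / B ^ i) % B
  where instance _ = m^n≢0 B i

-- base-B lunar multiplication: c_i = max_{j+l=i} min(x_j, y_l), x ⊗ y = Σ_i c_i B^i.
-- All digits of index ≥ x + y vanish for c_i (x_j ≠ 0 forces j < x), so summing
-- over i < x + y + 1 gives the full (formally infinite) sum.
lunarMul : (B : ℕ) → .{{_ : NonZero B}} → ℕ → ℕ → ℕ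
lunarMul B x y = sumBelow (suc (x + y)) λ i →
  maxUpTo i (λ j → digit B x j ⊓ digit B y (i ∸ j)) * B ^ i

-- Since 0 ≤ f ≤ b, the base-(b+1) digits of β f are the values f(0), f(1), ….
-- The k-th set of the array of h = f + g is a sumset, so h(i) ≥ k iff i = x + y with
-- f(x) ≥ k and g(y) ≥ k; hence h(i) = max_{x+y=i} min(f(x), g(y)), which is the
-- lunar-product formula for digit i of β f ⊗ β g.  The lunar sum only runs over
-- i ≤ β f + β g, but that covers the support of h, as x < (b+1)^x ≤ β f when f(x) ≥ 1.
module Submission where

open import Defs
open import Data.Nat using (ℕ; zero; suc; _+_; _*_; _∸_; _^_; _≤_; _<_; _⊔_; _⊓_; z≤n; s≤s; NonZero; >-nonZero; >-nonZero⁻¹)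
open import Data.Nat.Properties
open import Data.Nat.DivMod
open import Data.Nat.Divisibility using (divides-refl)
open import Data.Nat.Tactic.RingSolver using (solve-∀)
open import Data.Product using (_×_; _,_; proj₁; proj₂; ∃₂)
open import Data.Sum using (inj₁; inj₂)
open import Function.Bundles using (Equivalence)
open import Relation.Nullary using (yes; no; contradiction)
open import Relation.Binary.PropositionalEquality

sumBelow-cong : ∀ n {F G : ℕ → ℕ} → (∀ i → F i ≡ G i) → sumBelow n F ≡ sumBelow n G
sumBelow-cong zero    F≗G = refl
sumBelow-cong (suc n) F≗G = cong₂ _+_ (sumBelow-cong n F≗G) (F≗G n)

term≤sumBelow : ∀ n (F : ℕ → ℕ) {i} → i < n → F i ≤ sumBelow n F
term≤sumBelow (suc n) F {i} i<1+n with i ≟ n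
... | yes refl = m≤n+m (F i) _
... | no  i≢n  = ≤-trans (term≤sumBelow n F (≤∧≢⇒< (≤-pred i<1+n) i≢n)) (m≤m+n _ _)

sumBelow-padding : ∀ {n} (F : ℕ → ℕ) → (∀ i → n ≤ i → F i ≡ 0) →
                   ∀ k → sumBelow (k + n) F ≡ sumBelow n F
sumBelow-padding F vanish zero    = refl
sumBelow-padding {n} F vanish (suc k) = begin
  sumBelow (k + n) F + F (k + n) ≡⟨ cong₂ _+_ (sumBelow-padding F vanish k) (vanish _ (m≤n+m n k)) ⟩
  sumBelow n F + 0               ≡⟨ +-identityʳ _ ⟩
  sumBelow n F                   ∎
  where open ≡-Reasoning

sumBelow-vanishing : ∀ {m n} (F : ℕ → ℕ) → (∀ i → m ≤ i → F i ≡ 0) → (∀ i → n ≤ i → F i ≡ 0) →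
                     sumBelow m F ≡ sumBelow n F
sumBelow-vanishing {m} {n} F vanishₘ vanishₙ with ≤-total m n
... | inj₁ m≤n = sym (subst (λ t → sumBelow t F ≡ sumBelow m F) (m∸n+n≡m m≤n) (sumBelow-padding F vanishₘ (n ∸ m)))
... | inj₂ n≤m = subst (λ t → sumBelow t F ≡ sumBelow n F) (m∸n+n≡m n≤m) (sumBelow-padding F vanishₙ (m ∸ n))

maxUpTo-cong : ∀ n {F G : ℕ → ℕ} → (∀ i → F i ≡ G i) → maxUpTo n F ≡ maxUpTo n G
maxUpTo-cong zero    F≗G = F≗G 0
maxUpTo-cong (suc n) F≗G = cong₂ _⊔_ (maxUpTo-cong n F≗G) (F≗G (suc n))

term≤maxUpTo : ∀ n (F : ℕ → ℕ) {j} → j ≤ n → F j ≤ maxUpTo n F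
term≤maxUpTo zero    F z≤n = ≤-refl
term≤maxUpTo (suc n) F {j} j≤1+n with j ≟ suc n
... | yes refl = m≤n⊔m _ _
... | no  j≢1+n = ≤-trans (term≤maxUpTo n F (≤-pred (≤∧≢⇒< j≤1+n j≢1+n))) (m≤m⊔n _ _)

maxUpTo-lub : ∀ n (F : ℕ → ℕ) {m} → (∀ j → j ≤ n → F j ≤ m) → maxUpTo n F ≤ m
maxUpTo-lub zero    F bound = bound 0 z≤n
maxUpTo-lub (suc n) F bound = ⊔-lub (maxUpTo-lub n F (λ j j≤n → bound j (m≤n⇒m≤1+n j≤n))) (bound (suc n) ≤-refl)

expansion : (B : ℕ) → ℕ → (ℕ → ℕ) → ℕ
expansion B n d = sumBelow n λ i → d i * B ^ i

expansion-horner : ∀ B n (d : ℕ → ℕ) →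
                   expansion B (suc n) d ≡ d 0 + expansion B n (λ i → d (suc i)) * B
expansion-horner B zero    d = trans (*-identityʳ (d 0)) (sym (+-identityʳ (d 0)))
expansion-horner B (suc n) d = begin
  expansion B (suc n) d + d (suc n) * B ^ suc n
    ≡⟨ cong (_+ d (suc n) * B ^ suc n) (expansion-horner B n d) ⟩
  d 0 + e * B + d (suc n) * (B * B ^ n)
    ≡⟨ regroup (d 0) e (d (suc n)) B (B ^ n) ⟩
  d 0 + (e + d (suc n) * B ^ n) * B ∎
  where
  open ≡-Reasoning
  e = expansion B n (λ i → d (suc i))
  regroup : ∀ a e c B p → a + e * B + c * (B * p) ≡ a + (e + c * p) * B
  regroup = solve-∀

[m+kn]/n≡k : ∀ {m} k {n} .{{_ : NonZero n}} → m < n → (m + k * n) / n ≡ k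
[m+kn]/n≡k {m} k {n} m<n = begin
  (m + k * n) / n   ≡⟨ +-distrib-/-∣ʳ m (divides-refl k) ⟩
  m / n + k * n / n ≡⟨ cong₂ _+_ (m<n⇒m/n≡0 m<n) (m*n/n≡m k n) ⟩
  k                 ∎
  where open ≡-Reasoning

digit-zero : ∀ B .{{_ : NonZero B}} x → digit B x 0 ≡ x % B
digit-zero B x = cong (_% B) (n/1≡n x)

digit-suc : ∀ B .{{_ : NonZero B}} x j → digit B x (suc j) ≡ digit B (x / B) j
digit-suc B x j = cong (_% B) (sym (m/n/o≡m/[n*o] x B (B ^ j) {{_}} {{m^n≢0 B j}} {{m^n≢0 B (suc j)}}))

digit-of-zero : ∀ B .{{_ : NonZero B}} j → digit B 0 j ≡ 0
digit-of-zero B j = trans (cong (_% B) (0/n≡0 (B ^ j) {{m^n≢0 B j}})) (m<n⇒m%n≡m (>-nonZero⁻¹ B))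

digit-expansion : ∀ B .{{_ : NonZero B}} n (d : ℕ → ℕ) → (∀ i → d i < B) →
                  (∀ i → n ≤ i → d i ≡ 0) → ∀ j → digit B (expansion B n d) j ≡ d j
digit-expansion B zero    d d<B vanish j = trans (digit-of-zero B j) (sym (vanish j z≤n))
digit-expansion B (suc n) d d<B vanish zero = begin
  digit B (expansion B (suc n) d) 0 ≡⟨ digit-zero B _ ⟩
  expansion B (suc n) d % B        ≡⟨ cong (_% B) (expansion-horner B n d) ⟩
  (d 0 + expansion B n d′ * B) % B ≡⟨ [m+kn]%n≡m%n (d 0) (expansion B n d′) B ⟩
  d 0 % B                          ≡⟨ m<n⇒m%n≡m (d<B 0) ⟩
  d 0                              ∎
  where
  open ≡-Reasoning
  d′ = λ i → d (suc i)
digit-expansion B (suc n) d d<B vanish (suc j) = begin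
  digit B (expansion B (suc n) d) (suc j)         ≡⟨ digit-suc B _ j ⟩
  digit B (expansion B (suc n) d / B) j           ≡⟨ cong (λ x → digit B (x / B) j) (expansion-horner B n d) ⟩
  digit B ((d 0 + expansion B n d′ * B) / B) j    ≡⟨ cong (λ x → digit B x j) ([m+kn]/n≡k _ (d<B 0)) ⟩
  digit B (expansion B n d′) j                    ≡⟨ digit-expansion B n d′ (λ i → d<B (suc i)) (λ i n≤i → vanish (suc i) (s≤s n≤i)) j ⟩
  d′ j                                            ∎
  where
  open ≡-Reasoning
  d′ = λ i → d (suc i)

n<m^n : ∀ {m} → 1 < m → ∀ n → n < m ^ n
n<m^n 1<m zero    = s≤s z≤n
n<m^n {m@(suc _)} 1<m (suc n) = begin-strict
  suc n           <⟨ s≤s (n<m^n 1<m n) ⟩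
  1 + m ^ n       ≤⟨ +-monoˡ-≤ (m ^ n) (m^n>0 m n) ⟩
  m ^ n + m ^ n   ≡⟨ cong (m ^ n +_) (+-identityʳ (m ^ n)) ⟨
  2 * m ^ n       ≤⟨ *-monoˡ-≤ (m ^ n) 1<m ⟩
  m * m ^ n       ∎
  where open ≤-Reasoning

≤-byPositiveLevels : ∀ {m n} → (∀ k → 1 ≤ k → k ≤ m → k ≤ n) → m ≤ n
≤-byPositiveLevels {zero}  levels = z≤n
≤-byPositiveLevels {suc m} levels = levels (suc m) (s≤s z≤n) ≤-refl

maxMinConv : (ℕ → ℕ) → (ℕ → ℕ) → ℕ → ℕ
maxMinConv F G i = maxUpTo i λ j → F j ⊓ G (i ∸ j)

module _ {b : ℕ} where

  β-expansion : (f : M b) → ∀ {n} → (∀ i → n ≤ i → fn f i ≡ 0) → β f ≡ expansion (suc b) n (fn f)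
  β-expansion f vanish = sumBelow-vanishing _
    (λ i N≤i → cong (_* suc b ^ i) (proj₂ (finSupp f) i N≤i))
    (λ i n≤i → cong (_* suc b ^ i) (vanish i n≤i))

  digit-β : (f : M b) → ∀ j → digit (suc b) (β f) j ≡ fn f j
  digit-β f = digit-expansion (suc b) _ (fn f) (λ i → s≤s (bounded f i)) (proj₂ (finSupp f))

  support<β : 1 ≤ b → (f : M b) → ∀ {x} → 1 ≤ fn f x → x < β f
  support<β 1≤b f {x} 1≤f with proj₁ (finSupp f) ≤? x
  ... | yes N≤x = contradiction (proj₂ (finSupp f) x N≤x) (λ f≡0 → <⇒≱ 1≤f (≤-reflexive f≡0))
  ... | no  N≰x = begin-strict
    x                  <⟨ n<m^n (s≤s 1≤b) x ⟩
    suc b ^ x          ≤⟨ m≤n*m (suc b ^ x) (fn f x) {{>-nonZero 1≤f}} ⟩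
    fn f x * suc b ^ x ≤⟨ term≤sumBelow _ (λ i → fn f i * suc b ^ i) (≰⇒> N≰x) ⟩
    β f                ∎
    where open ≤-Reasoning

module MultisumsetSum {b} (f g h : M b) (sum : IsMultisumsetSum f g h) where

  level-decomposition : ∀ {k} → 1 ≤ k → ∀ i → k ≤ fn h i →
                        ∃₂ λ x y → x + y ≡ i × k ≤ fn f x × k ≤ fn g y
  level-decomposition 1≤k i k≤h = Equivalence.to (sum _ 1≤k (≤-trans k≤h (bounded h i)) i) k≤h

  level-composition : ∀ {k} → 1 ≤ k → ∀ x y → k ≤ fn f x → k ≤ fn g y → k ≤ fn h (x + y)
  level-composition 1≤k x y k≤f k≤g =
    Equivalence.from (sum _ 1≤k (≤-trans k≤f (bounded f x)) (x + y)) (x , y , refl , k≤f , k≤g)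

  fn≡maxMinConv : ∀ i → fn h i ≡ maxMinConv (fn f) (fn g) i
  fn≡maxMinConv i = ≤-antisym (≤-byPositiveLevels attained) (maxUpTo-lub i _ bounded-by-h)
    where
    attained : ∀ k → 1 ≤ k → k ≤ fn h i → k ≤ maxMinConv (fn f) (fn g) i
    attained k 1≤k k≤h with level-decomposition 1≤k i k≤h
    ... | x , y , refl , k≤f , k≤g =
      ≤-trans (⊓-glb k≤f (subst (λ t → k ≤ fn g t) (sym (m+n∸m≡n x y)) k≤g))
              (term≤maxUpTo (x + y) _ (m≤m+n x y))
    bounded-by-h : ∀ j → j ≤ i → fn f j ⊓ fn g (i ∸ j) ≤ fn h i
    bounded-by-h j j≤i = ≤-byPositiveLevels λ k 1≤k k≤min →
      subst (λ t → k ≤ fn h t) (m+[n∸m]≡n j≤i)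
        (level-composition 1≤k j (i ∸ j) (≤-trans k≤min (m⊓n≤m _ _)) (≤-trans k≤min (m⊓n≤n _ _)))

  fn≡lunarDigit : ∀ i → fn h i ≡ maxMinConv (digit (suc b) (β f)) (digit (suc b) (β g)) i
  fn≡lunarDigit i = trans (fn≡maxMinConv i)
    (maxUpTo-cong i λ j → sym (cong₂ _⊓_ (digit-β f j) (digit-β g (i ∸ j))))

  support<β+β : 1 ≤ b → ∀ {i} → 1 ≤ fn h i → i < β f + β g
  support<β+β 1≤b {i} 1≤h with level-decomposition ≤-refl i 1≤h
  ... | x , y , refl , 1≤f , 1≤g = +-mono-< (support<β 1≤b f 1≤f) (support<β 1≤b g 1≤g)

  vanishing : 1 ≤ b → ∀ i → β f + β g ≤ i → fn h i ≡ 0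
  vanishing 1≤b i β+β≤i = n<1⇒n≡0 (≰⇒> λ 1≤h → <⇒≱ (support<β+β 1≤b 1≤h) β+β≤i)

mainTheorem10 : (b : ℕ) → 1 ≤ b →
    ((f g h : M b) → IsMultisumsetSum f g h → β h ≡ lunarMul (suc b) (β f) (β g))
    × (β (unitM b) ≡ b)
mainTheorem10 b 1≤b = β-lunar , *-identityʳ b
  where
  β-lunar : (f g h : M b) → IsMultisumsetSum f g h → β h ≡ lunarMul (suc b) (β f) (β g)
  β-lunar f g h sum = begin
    β h
      ≡⟨ β-expansion h (λ i β+β<i → vanishing 1≤b i (<⇒≤ β+β<i)) ⟩
    expansion (suc b) (suc (β f + β g)) (fn h)
      ≡⟨ sumBelow-cong _ (λ i → cong (_* suc b ^ i) (fn≡lunarDigit i)) ⟩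
    lunarMul (suc b) (β f) (β g) ∎
    where
    open ≡-Reasoning
    open MultisumsetSum f g h sum
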